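{- Let $S\subseteq\mathbb N$ be a numerical semigroup with multiplicity $m$, embedding dimension $\nu$ and conductor $f+1=qm-\rho$ for some $q\in\mathbb N$ and $0\le\rho\le m-1$. Let $\mathrm{Ap}(S,m)=\{w_0=0<w_1<\dots<w_{m-1}\}$. Suppose that $w_{m-1}\ge w_1+w_\alpha$ for some integer $\alpha$ with $1<\alpha<m-1$. If $\left(2+\frac{\alpha-3}{q}\right)\nu\ge m$, then $S$ satisfies Wilf's Conjecture, i.e. $f+1\le \nu\, n$.
   Context: A numerical semigroup is a submonoid of $(\mathbb N,+)$ with finite complement. $f$ is the Frobenius number (largest integer not in $S$), $m$ the smallest nonzero element of $S$, $\nu$ the minimal number of generators, and $n=|\{s\in S: s<f\}|$. The Apéry set is $\mathrm{Ap}(S,m)=\{s\in S: s-m\notin S\}$, which has exactly $m$ elements, listed increasingly as $w_0<\dots<w_{m-1}$. $S$ satisfies Wilf's Conjecture if $f+1\le \nu n$. -}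

module Defs where

open import Data.Bool using (Bool; true; false)
open import Data.Nat using (ℕ; zero; suc; _+_; _*_; _∸_; _≤_; _<_)
open import Data.List using (List; length)
open import Data.List.Membership.Propositional using (_∈_)
open import Data.Product using (Σ; ∃; _×_)
open import Data.Sum using (_⊎_)
open import Relation.Binary.PropositionalEquality using (_≡_)

record NumericalSemigroup : Set where
  field
    mem      : ℕ → Bool
    zero∈    : mem 0 ≡ true
    closed   : ∀ a b → mem a ≡ true → mem b ≡ true → mem (a + b) ≡ true
    cofinite : ∃ λ N → ∀ x → N ≤ x → mem x ≡ true
open NumericalSemigroup public

_∈S_ : ℕ → NumericalSemigroup → Set
x ∈S S = mem S x ≡ true

_∉S_ : ℕ → NumericalSemigroup → Set
x ∉S S = mem S x ≡ false

IsMultiplicity : NumericalSemigroup → ℕ → Set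
IsMultiplicity S m = (0 < m) × (m ∈S S) × (∀ x → 0 < x → x < m → x ∉S S)

-- c is the conductor f + 1: the least c such that every x ≥ c lies in S.
IsConductor : NumericalSemigroup → ℕ → Set
IsConductor S c = (∀ x → c ≤ x → x ∈S S)
                × (∀ c' → (∀ x → c' ≤ x → x ∈S S) → c ≤ c')

data Generated (G : List ℕ) : ℕ → Set where
  gen-zero : Generated G 0
  gen-add  : ∀ {g y} → g ∈ G → Generated G y → Generated G (g + y)

Generates : NumericalSemigroup → List ℕ → Set
Generates S G = (∀ g → g ∈ G → g ∈S S) × (∀ x → x ∈S S → Generated G x)

IsEmbDim : NumericalSemigroup → ℕ → Set
IsEmbDim S ν = (Σ (List ℕ) λ G → Generates S G × length G ≡ ν)
             × (∀ G → Generates S G → ν ≤ length G)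

countBelow : NumericalSemigroup → ℕ → ℕ
countBelow S zero = 0
countBelow S (suc k) with mem S k
... | true  = suc (countBelow S k)
... | false = countBelow S k

-- Apéry set Ap(S,m) = {s ∈ S : s - m ∉ S} (s < m means s - m is negative, so not in S).
InApery : NumericalSemigroup → ℕ → ℕ → Set
InApery S m s = (s ∈S S) × ((s < m) ⊎ ((m ≤ s) × ((s ∸ m) ∉S S)))

IsAperyEnum : NumericalSemigroup → ℕ → (ℕ → ℕ) → Set
IsAperyEnum S m w = (∀ i j → i < j → j < m → w i < w j)
                  × (∀ i → i < m → InApery S m (w i))
                  × (∀ s → InApery S m s → ∃ λ i → (i < m) × (w i ≡ s))

-- Every element of S is uniquely w i + k * m with i < m, and w i + k * m ∈ S for all k.
-- Counting, for i = 0, 1, …, α, the k with w i + k * m ≤ f gives at least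
-- q elements for i = 0 (as q m ≤ f + m), at least q − 1 for i ∈ {1, α} together
-- (as w 1 + w α ≤ w (m − 1) ≤ f + m), and at least one for each 1 < i < α (as w i < w α ≤ f).
-- So n ≥ 2q + α − 3, while the rational hypothesis says q m ≤ ν (2q + α − 3) and f + 1 ≤ q m.
module Submission where

open import Defs
open import Data.Bool using (true; false)
open import Data.Nat as ℕ using (ℕ; zero; suc; _+_; _*_; _∸_; _/_; _≤_; _<_; z≤n; s≤s; z<s;
                                 _≟_; _≤?_; NonZero; >-nonZero)
open import Data.Nat.Properties
open import Data.Nat.DivMod using (m/n*n≤m; m*n/n≡m; /-monoˡ-≤; m≡m%n+[m/n]*n; m%n<n)
open import Data.Nat.ListAction using (sum)
open import Data.Nat.Tactic.RingSolver using (solve)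
open import Data.Integer as ℤ using (ℤ; +_)
import Data.Integer.Properties as ℤ
import Data.Integer.Tactic.RingSolver as ℤ
import Data.Rational as ℚ
import Data.Rational.Properties as ℚ
import Data.Rational.Unnormalised as ℚᵘ
import Data.Rational.Unnormalised.Properties as ℚᵘ
open import Data.List using (List; []; _∷_; _++_; length; filter; applyUpTo; applyDownFrom)
open import Data.List.Properties using (length-++; length-applyUpTo; filter-all; filter-accept; filter-reject)
open import Data.List.Membership.Propositional using (_∈_)
open import Data.List.Membership.Propositional.Properties using (∈-++⁻; ∈-filter⁻; ∈-applyUpTo⁻)
open import Data.List.Relation.Unary.Any using (here)
import Data.List.Relation.Unary.All as All
import Data.List.Relation.Unary.AllPairs as AllPairs
open import Data.List.Relation.Unary.Unique.Propositional using (Unique)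
import Data.List.Relation.Unary.Unique.Propositional.Properties as Unique
open import Data.List.Relation.Binary.Disjoint.Propositional using (Disjoint)
open import Data.Product using (∃₂; _×_; _,_; proj₁; proj₂)
open import Data.Sum using (inj₁; inj₂)
open import Function using (_∘_)
open import Relation.Nullary using (¬_; ¬?; yes; no; contradiction)
open import Relation.Binary using (tri<; tri≈; tri>)
open import Relation.Binary.PropositionalEquality
  using (_≡_; _≢_; refl; sym; trans; cong; cong₂; subst; subst₂; module ≡-Reasoning)

m*n≤o⇒m≤o/n : ∀ {m} n {o} .{{_ : NonZero n}} → m * n ≤ o → m ≤ o / n
m*n≤o⇒m≤o/n {m} n le = subst (_≤ _ / n) (m*n/n≡m m n) (/-monoˡ-≤ n le)

m<o/n⇒[1+m]*n≤o : ∀ {m} n {o} .{{_ : NonZero n}} → m < o / n → suc m * n ≤ o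
m<o/n⇒[1+m]*n≤o n {o} lt = ≤-trans (*-monoˡ-≤ n lt) (m/n*n≤m o n)

m<[1+m/n]*n : ∀ m n .{{_ : NonZero n}} → m < suc (m / n) * n
m<[1+m/n]*n m n = begin-strict
  m                   ≡⟨ m≡m%n+[m/n]*n m n ⟩
  m ℕ.% n + m / n * n <⟨ +-monoˡ-< (m / n * n) (m%n<n m n) ⟩
  suc (m / n) * n     ∎
  where open ≤-Reasoning

[1+m]*o≤n₁+n₂⇒m≤n₁/o+n₂/o : ∀ {m} n₁ n₂ o .{{_ : NonZero o}} →
                            suc m * o ≤ n₁ + n₂ → m ≤ n₁ / o + n₂ / o
[1+m]*o≤n₁+n₂⇒m≤n₁/o+n₂/o {m} n₁ n₂ o le =
  ≤-pred (≤-pred (*-cancelʳ-< o (suc m) (suc (suc (n₁ / o + n₂ / o))) (begin-strict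
    suc m * o                             ≤⟨ le ⟩
    n₁ + n₂                               <⟨ +-mono-< (m<[1+m/n]*n n₁ o) (m<[1+m/n]*n n₂ o) ⟩
    suc (n₁ / o) * o + suc (n₂ / o) * o   ≡⟨ *-distribʳ-+ o (suc (n₁ / o)) (suc (n₂ / o)) ⟨
    (suc (n₁ / o) + suc (n₂ / o)) * o     ≡⟨ cong (λ x → suc x * o) (+-suc (n₁ / o) (n₂ / o)) ⟩
    suc (suc (n₁ / o + n₂ / o)) * o       ∎)))
  where open ≤-Reasoning

m+n≤o⇒o≤[o∸m]+[o∸n] : ∀ m n {o} → m + n ≤ o → o ≤ (o ∸ m) + (o ∸ n)
m+n≤o⇒o≤[o∸m]+[o∸n] m n {o} le = begin
  o             ≡⟨ m+[n∸m]≡n (≤-trans (m≤n+m n m) le) ⟨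
  n + (o ∸ n)   ≤⟨ +-monoˡ-≤ (o ∸ n) (m+n≤o⇒m≤o∸n n (subst (_≤ o) (+-comm m n) le)) ⟩
  (o ∸ m) + (o ∸ n) ∎
  where open ≤-Reasoning

sum-applyDownFrom-≥ : ∀ (t : ℕ → ℕ) a n → (∀ i → a ≤ i → i < a + n → 1 ≤ t i) →
                      n + sum (applyDownFrom t a) ≤ sum (applyDownFrom t (a + n))
sum-applyDownFrom-≥ t a zero _ = ≤-reflexive (cong (sum ∘ applyDownFrom t) (sym (+-identityʳ a)))
sum-applyDownFrom-≥ t a (suc n) positive = begin
  suc n + sum (applyDownFrom t a)            ≤⟨ +-mono-≤ (positive (a + n) (m≤m+n a n) a+n<a+1+n)
                                                         (sum-applyDownFrom-≥ t a n positive′) ⟩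
  t (a + n) + sum (applyDownFrom t (a + n))  ≡⟨ cong (sum ∘ applyDownFrom t) (+-suc a n) ⟨
  sum (applyDownFrom t (a + suc n))          ∎
  where
  open ≤-Reasoning
  a+n<a+1+n = +-monoʳ-< a (n<1+n n)
  positive′ : ∀ i → a ≤ i → i < a + n → 1 ≤ t i
  positive′ i a≤i i<a+n = positive i a≤i (<-trans i<a+n a+n<a+1+n)

length≤1+length-filter-≢ : ∀ K {xs : List ℕ} → Unique xs →
                           length xs ≤ suc (length (filter (¬? ∘ (_≟ K)) xs))
length≤1+length-filter-≢ K {[]} _ = z≤n
length≤1+length-filter-≢ K {x ∷ xs} (x∉xs AllPairs.∷ unique) with x ≟ K
... | yes refl = s≤s (≤-reflexive (cong length (begin
  xs                            ≡⟨ filter-all (¬? ∘ (_≟ x)) (All.map (λ x≢y y≡x → x≢y (sym y≡x)) x∉xs) ⟨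
  filter (¬? ∘ (_≟ x)) xs       ≡⟨ filter-reject (¬? ∘ (_≟ x)) (contradiction refl) ⟨
  filter (¬? ∘ (_≟ x)) (x ∷ xs) ∎)))
  where open ≡-Reasoning
... | no x≢K = subst (λ ys → suc (length xs) ≤ suc (length ys))
                     (sym (filter-accept (¬? ∘ (_≟ K)) x≢K))
                     (s≤s (length≤1+length-filter-≢ K unique))

module _ (S : NumericalSemigroup) where

  ∈S⇒¬∉S : ∀ {x} → x ∈S S → ¬ (x ∉S S)
  ∈S⇒¬∉S x∈S x∉S with () ← trans (sym x∈S) x∉S

  length≤countBelow : ∀ K {xs : List ℕ} → Unique xs → (∀ {x} → x ∈ xs → x ∈S S × x < K) →
                      length xs ≤ countBelow S K
  length≤countBelow zero {[]} _ _ = z≤n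
  length≤countBelow zero {x ∷ _} _ bounded = contradiction (proj₂ (bounded (here refl))) λ ()
  length≤countBelow (suc K) {xs} unique bounded with mem S K in K∈?
  ... | true = begin
      length xs         ≤⟨ length≤1+length-filter-≢ K unique ⟩
      suc (length xs⁻)  ≤⟨ s≤s (length≤countBelow K (Unique.filter⁺ (¬? ∘ (_≟ K)) unique) bounded⁻) ⟩
      suc (countBelow S K) ∎
    where
    open ≤-Reasoning
    xs⁻ = filter (¬? ∘ (_≟ K)) xs
    bounded⁻ : ∀ {x} → x ∈ xs⁻ → x ∈S S × x < K
    bounded⁻ x∈xs⁻ with x∈xs , x≢K ← ∈-filter⁻ (¬? ∘ (_≟ K)) x∈xs⁻ =
      proj₁ (bounded x∈xs) , ≤∧≢⇒< (≤-pred (proj₂ (bounded x∈xs))) x≢K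
  ... | false = length≤countBelow K unique λ x∈xs →
      let x∈S , x<1+K = bounded x∈xs in
      x∈S , ≤∧≢⇒< (≤-pred x<1+K) λ { refl → ∈S⇒¬∉S x∈S K∈? }

  ∉S⇒<conductor : ∀ {c x} → IsConductor S c → x ∉S S → x < c
  ∉S⇒<conductor {c} {x} conductor x∉S with c ≤? x
  ... | yes c≤x = contradiction x∉S (∈S⇒¬∉S (proj₁ conductor x c≤x))
  ... | no c≰x = ≰⇒> c≰x

  frobenius∉S : ∀ {f} → IsConductor S (suc f) → f ∉S S
  frobenius∉S {f} conductor with mem S f in f∈?
  ... | false = refl
  ... | true = contradiction (proj₂ conductor f from-f) (<-irrefl refl)
    where
    from-f : ∀ x → f ≤ x → x ∈S S
    from-f x f≤x with m≤n⇒m<n∨m≡n f≤x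
    ... | inj₁ f<x = proj₁ conductor x f<x
    ... | inj₂ refl = f∈?

module Apery {S : NumericalSemigroup} {m : ℕ} {w : ℕ → ℕ}
             (multiplicity : IsMultiplicity S m) (apery : IsAperyEnum S m w) where

  private instance
    m-nonZero : NonZero m
    m-nonZero = >-nonZero (proj₁ multiplicity)

  *m∈S : ∀ k → (k * m) ∈S S
  *m∈S zero = zero∈ S
  *m∈S (suc k) = closed S m (k * m) (proj₁ (proj₂ multiplicity)) (*m∈S k)

  w∈S : ∀ {i} → i < m → w i ∈S S
  w∈S i<m = proj₁ (proj₁ (proj₂ apery) _ i<m)

  w-strictMono : ∀ {i j} → i < j → j < m → w i < w j
  w-strictMono = proj₁ apery _ _

  w-injective : ∀ {i j} → i < m → j < m → w i ≡ w j → i ≡ j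
  w-injective {i} {j} i<m j<m eq with <-cmp i j
  ... | tri< i<j _ _ = contradiction eq (<⇒≢ (w-strictMono i<j j<m))
  ... | tri≈ _ i≡j _ = i≡j
  ... | tri> _ _ j<i = contradiction (sym eq) (<⇒≢ (w-strictMono j<i i<m))

  w₀≡0 : w 0 ≡ 0
  w₀≡0 with proj₂ (proj₂ apery) 0 (zero∈ S , inj₁ (proj₁ multiplicity))
  ... | zero , _ , w₀≡0 = w₀≡0
  ... | suc i , 1+i<m , wᵢ≡0 = contradiction (subst (w 0 <_) wᵢ≡0 (w-strictMono z<s 1+i<m)) λ ()

  m≤w₁ : 1 < m → m ≤ w 1
  m≤w₁ 1<m with m ≤? w 1
  ... | yes m≤w₁ = m≤w₁
  ... | no m≰w₁ = contradiction (proj₂ (proj₂ multiplicity) (w 1) 0<w₁ (≰⇒> m≰w₁)) (∈S⇒¬∉S S (w∈S 1<m))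
    where
    0<w₁ : 0 < w 1
    0<w₁ = subst (_< w 1) w₀≡0 (w-strictMono z<s 1<m)

  w≢∈S+[1+k]*m : ∀ {i x} k → i < m → x ∈S S → w i ≢ x + suc k * m
  w≢∈S+[1+k]*m {i} {x} k i<m x∈S wᵢ≡ with proj₂ (proj₁ (proj₂ apery) i i<m)
  ... | inj₁ wᵢ<m = <⇒≱ wᵢ<m (subst (m ≤_) (sym wᵢ≡) (≤-trans (m≤m+n m (k * m)) (m≤n+m _ x)))
  ... | inj₂ (_ , wᵢ∸m∉S) =
    ∈S⇒¬∉S S (closed S x (k * m) x∈S (*m∈S k)) (trans (cong (mem S) wᵢ∸m≡) wᵢ∸m∉S)
    where
    open ≡-Reasoning
    wᵢ∸m≡ : x + k * m ≡ w i ∸ m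
    wᵢ∸m≡ = begin
      x + k * m           ≡⟨ m+n∸n≡m (x + k * m) m ⟨
      x + k * m + m ∸ m   ≡⟨ cong (_∸ m) (solve (x ∷ k ∷ m ∷ [])) ⟩
      x + suc k * m ∸ m   ≡⟨ cong (_∸ m) wᵢ≡ ⟨
      w i ∸ m             ∎

  <⇒w+*m≢w+*m : ∀ {i j k l} → i < m → j < m → k < l → w i + k * m ≢ w j + l * m
  <⇒w+*m≢w+*m {i} {j} {k} i<m j<m k<l eq with d , refl ← m≤n⇒∃[o]m+o≡n k<l =
    w≢∈S+[1+k]*m d i<m (w∈S j<m) (+-cancelʳ-≡ (k * m) _ _ (trans eq (regroup (w j))))
    where
    regroup : ∀ x → x + (suc k + d) * m ≡ x + suc d * m + k * m
    regroup x = solve (x ∷ k ∷ d ∷ m ∷ [])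

  w+*m-injectiveˡ : ∀ {i j} k l → i < m → j < m → w i + k * m ≡ w j + l * m → i ≡ j
  w+*m-injectiveˡ k l i<m j<m eq with <-cmp k l
  ... | tri< k<l _ _ = contradiction eq (<⇒w+*m≢w+*m i<m j<m k<l)
  ... | tri≈ _ refl _ = w-injective i<m j<m (+-cancelʳ-≡ (k * m) _ _ eq)
  ... | tri> _ _ l<k = contradiction (sym eq) (<⇒w+*m≢w+*m j<m i<m l<k)

  classElems : ℕ → ℕ → List ℕ
  classElems i t = applyUpTo (λ k → w i + k * m) t

  classesElems : (ℕ → ℕ) → ℕ → List ℕ
  classesElems t zero = []
  classesElems t (suc i) = classElems i (t i) ++ classesElems t i

  length-classesElems : ∀ t n → length (classesElems t n) ≡ sum (applyDownFrom t n)
  length-classesElems t zero = refl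
  length-classesElems t (suc i) = trans (length-++ (classElems i (t i)))
                                        (cong₂ _+_ (length-applyUpTo _ (t i)) (length-classesElems t i))

  ∈-classesElems⁻ : ∀ t n {v} → v ∈ classesElems t n → ∃₂ λ i k → i < n × k < t i × v ≡ w i + k * m
  ∈-classesElems⁻ t (suc i) v∈ with ∈-++⁻ (classElems i (t i)) v∈
  ... | inj₁ v∈class = let k , k<t , v≡ = ∈-applyUpTo⁻ _ v∈class in i , k , ≤-refl , k<t , v≡
  ... | inj₂ v∈rest = let j , k , j<i , k<t , v≡ = ∈-classesElems⁻ t i v∈rest in
                      j , k , m<n⇒m<1+n j<i , k<t , v≡

  classesElems-unique : ∀ t n → n ≤ m → Unique (classesElems t n)
  classesElems-unique t zero _ = AllPairs.[]
  classesElems-unique t (suc i) i<m = Unique.++⁺ class-unique (classesElems-unique t i (<⇒≤ i<m)) disjoint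
    where
    class-unique : Unique (classElems i (t i))
    class-unique = Unique.applyUpTo⁺₁ _ (t i) λ k<l _ eq →
      <⇒≢ k<l (*-cancelʳ-≡ _ _ m (+-cancelˡ-≡ (w i) _ _ eq))
    disjoint : Disjoint (classElems i (t i)) (classesElems t i)
    disjoint (v∈class , v∈rest) with k , _ , refl ← ∈-applyUpTo⁻ _ v∈class
                                   | j , l , j<i , _ , eq ← ∈-classesElems⁻ t i v∈rest =
      <⇒≢ j<i (sym (w+*m-injectiveˡ k l i<m (<-trans j<i i<m) eq))

  module _ {f : ℕ} (conductor : IsConductor S (suc f)) where

    w≤f+m : ∀ {i} → i < m → w i ≤ f + m
    w≤f+m {i} i<m with proj₂ (proj₁ (proj₂ apery) i i<m)
    ... | inj₁ wᵢ<m = ≤-trans (<⇒≤ wᵢ<m) (m≤n+m m f)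
    ... | inj₂ (m≤wᵢ , wᵢ∸m∉S) = begin
      w i         ≡⟨ m∸n+n≡m m≤wᵢ ⟨
      w i ∸ m + m ≤⟨ +-monoˡ-≤ m (≤-pred (∉S⇒<conductor S conductor wᵢ∸m∉S)) ⟩
      f + m       ∎
      where open ≤-Reasoning

    -- the number of k with w i + k * m ≤ f
    classSize : ℕ → ℕ
    classSize i = (f + m ∸ w i) / m

    <classSize⇒≤f : ∀ {i k} → i < m → k < classSize i → w i + k * m ≤ f
    <classSize⇒≤f {i} {k} i<m k<size = +-cancelʳ-≤ m _ _ (begin
      w i + k * m + m   ≡⟨ regroup (w i) ⟩
      suc k * m + w i   ≤⟨ m≤o∸n⇒m+n≤o (suc k * m) (w≤f+m i<m) (m<o/n⇒[1+m]*n≤o m k<size) ⟩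
      f + m             ∎)
      where
      open ≤-Reasoning
      regroup : ∀ x → x + k * m + m ≡ suc k * m + x
      regroup x = solve (x ∷ k ∷ m ∷ [])

    ≤classSize : ∀ {i k} → k * m + w i ≤ f + m → k ≤ classSize i
    ≤classSize le = m*n≤o⇒m≤o/n m (m+n≤o⇒m≤o∸n _ le)

    classesElems-below : ∀ {n v} → n ≤ m → v ∈ classesElems classSize n → v ∈S S × v < f
    classesElems-below {n} n≤m v∈ with i , k , i<n , k<size , refl ← ∈-classesElems⁻ classSize n v∈ =
      v∈S , ≤∧≢⇒< (<classSize⇒≤f i<m k<size) λ { refl → ∈S⇒¬∉S S v∈S (frobenius∉S S conductor) }
      where
      i<m = <-≤-trans i<n n≤m
      v∈S = closed S _ _ (w∈S i<m) (*m∈S k)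

    sum-classSize≤countBelow : ∀ n → n ≤ m → sum (applyDownFrom classSize n) ≤ countBelow S f
    sum-classSize≤countBelow n n≤m = subst (_≤ countBelow S f) (length-classesElems classSize n)
      (length≤countBelow S f (classesElems-unique classSize n n≤m) (classesElems-below n≤m))

    w≤f⇒1≤classSize : ∀ {i} → w i ≤ f → 1 ≤ classSize i
    w≤f⇒1≤classSize {i} wᵢ≤f = ≤classSize (begin
      1 * m + w i ≡⟨ cong (_+ w i) (*-identityˡ m) ⟩
      m + w i     ≡⟨ +-comm m (w i) ⟩
      w i + m     ≤⟨ +-monoˡ-≤ m wᵢ≤f ⟩
      f + m       ∎)
      where open ≤-Reasoning

    sum-classSize-≥ : ∀ Q a → suc Q * m ≤ f + m → 2 + a < m → w 1 + w (2 + a) ≤ f + m →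
                      suc Q + Q + a ≤ sum (applyDownFrom classSize (3 + a))
    sum-classSize-≥ Q a q*m≤f+m α<m w₁+wα≤f+m = begin
      suc Q + Q + a                                           ≤⟨ +-monoˡ-≤ a (+-mono-≤ size₀ size₁+sizeα) ⟩
      classSize 0 + (classSize 1 + classSize α) + a           ≡⟨ regroup (classSize 0) (classSize 1) (classSize α) ⟩
      classSize α + (a + sum (applyDownFrom classSize 2))     ≤⟨ +-monoʳ-≤ (classSize α) middle ⟩
      classSize α + sum (applyDownFrom classSize α)           ∎
      where
      open ≤-Reasoning
      α = 2 + a
      1<m = <-trans (s≤s (s≤s z≤n)) α<m

      regroup : ∀ x y z → x + (y + z) + a ≡ z + (a + (y + (x + 0)))
      regroup x y z = solve (x ∷ y ∷ z ∷ a ∷ [])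

      wα≤f : w α ≤ f
      wα≤f = +-cancelˡ-≤ m _ _ (begin
        m + w α     ≤⟨ +-monoˡ-≤ (w α) (m≤w₁ 1<m) ⟩
        w 1 + w α   ≤⟨ w₁+wα≤f+m ⟩
        f + m       ≡⟨ +-comm f m ⟩
        m + f       ∎)

      size₀ : suc Q ≤ classSize 0
      size₀ = ≤classSize (begin
        suc Q * m + w 0  ≡⟨ cong (_+_ (suc Q * m)) w₀≡0 ⟩
        suc Q * m + 0    ≡⟨ +-identityʳ (suc Q * m) ⟩
        suc Q * m        ≤⟨ q*m≤f+m ⟩
        f + m            ∎)

      size₁+sizeα : Q ≤ classSize 1 + classSize α
      size₁+sizeα = [1+m]*o≤n₁+n₂⇒m≤n₁/o+n₂/o (f + m ∸ w 1) (f + m ∸ w α) m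
                      (≤-trans q*m≤f+m (m+n≤o⇒o≤[o∸m]+[o∸n] (w 1) (w α) w₁+wα≤f+m))

      middle : a + sum (applyDownFrom classSize 2) ≤ sum (applyDownFrom classSize α)
      middle = sum-applyDownFrom-≥ classSize 2 a λ i _ i<α →
        w≤f⇒1≤classSize (≤-trans (<⇒≤ (w-strictMono i<α α<m)) wα≤f)

-- ℚ normalises by the gcd; ℚᵘ keeps the given numerators, so there ≤ is literal cross-multiplication.
ℚ-bound⇒ℤ-bound : ∀ m ν q (k : ℤ) .{{_ : NonZero q}} →
                  (+ m) ℚ./ 1 ℚ.≤ ((+ 2) ℚ./ 1 ℚ.+ k ℚ./ q) ℚ.* ((+ ν) ℚ./ 1) →
                  + (q * m) ℤ.≤ (+ 2 ℤ.* + q ℤ.+ k) ℤ.* + ν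
ℚ-bound⇒ℤ-bound m ν (suc Q) k le = subst₂ ℤ._≤_ lhs rhs (ℚᵘ.drop-*≤* unnormalised)
  where
  A = (+ 2) ℚ./ 1 ℚ.+ k ℚ./ suc Q
  C = (+ ν) ℚ./ 1

  unnormalised : ℚᵘ.mkℚᵘ (+ m) 0 ℚᵘ.≤ (ℚᵘ.mkℚᵘ (+ 2) 0 ℚᵘ.+ ℚᵘ.mkℚᵘ k Q) ℚᵘ.* ℚᵘ.mkℚᵘ (+ ν) 0
  unnormalised = begin
    ℚᵘ.mkℚᵘ (+ m) 0                                          ≃⟨ ℚ.toℚᵘ-fromℚᵘ (ℚᵘ.mkℚᵘ (+ m) 0) ⟨
    ℚ.toℚᵘ (+ m ℚ./ 1)                                       ≤⟨ ℚ.toℚᵘ-mono-≤ le ⟩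
    ℚ.toℚᵘ (A ℚ.* C)                                         ≃⟨ ℚ.toℚᵘ-homo-* A C ⟩
    ℚ.toℚᵘ A ℚᵘ.* ℚ.toℚᵘ C                                   ≃⟨ ℚᵘ.*-congʳ (ℚ.toℚᵘ-homo-+ (+ 2 ℚ./ 1) (k ℚ./ suc Q)) ⟩
    (ℚ.toℚᵘ (+ 2 ℚ./ 1) ℚᵘ.+ ℚ.toℚᵘ (k ℚ./ suc Q)) ℚᵘ.* ℚ.toℚᵘ C
      ≃⟨ ℚᵘ.*-cong (ℚᵘ.+-cong (ℚ.toℚᵘ-fromℚᵘ (ℚᵘ.mkℚᵘ (+ 2) 0)) (ℚ.toℚᵘ-fromℚᵘ (ℚᵘ.mkℚᵘ k Q)))
                   (ℚ.toℚᵘ-fromℚᵘ (ℚᵘ.mkℚᵘ (+ ν) 0)) ⟩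
    (ℚᵘ.mkℚᵘ (+ 2) 0 ℚᵘ.+ ℚᵘ.mkℚᵘ k Q) ℚᵘ.* ℚᵘ.mkℚᵘ (+ ν) 0 ∎
    where open ℚᵘ.≤-Reasoning

  lhs : + m ℤ.* + (1 * suc Q * 1) ≡ + (suc Q * m)
  lhs = trans (sym (ℤ.pos-* m _)) (cong +_ (solve (m ∷ Q ∷ [])))

  rhs : ((+ 2 ℤ.* + suc Q ℤ.+ k ℤ.* + 1) ℤ.* + ν) ℤ.* + 1 ≡ (+ 2 ℤ.* + suc Q ℤ.+ k) ℤ.* + ν
  rhs = regroup (+ suc Q) k (+ ν)
    where
    regroup : ∀ x y z → ((+ 2 ℤ.* x ℤ.+ y ℤ.* + 1) ℤ.* z) ℤ.* + 1 ≡ (+ 2 ℤ.* x ℤ.+ y) ℤ.* z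
    regroup = ℤ.solve-∀

ℚ-bound⇒q*m≤ν*[2q+α∸3] : ∀ m ν Q a →
  (+ m) ℚ./ 1 ℚ.≤ ((+ 2) ℚ./ 1 ℚ.+ ((+ (2 + a)) ℤ.- (+ 3)) ℚ./ suc Q) ℚ.* ((+ ν) ℚ./ 1) →
  suc Q * m ≤ ν * (suc Q + Q + a)
ℚ-bound⇒q*m≤ν*[2q+α∸3] m ν Q a le = ℤ.drop‿+≤+ (begin
  + (suc Q * m)                                          ≤⟨ ℚ-bound⇒ℤ-bound m ν (suc Q) (+ (2 + a) ℤ.- + 3) le ⟩
  (+ 2 ℤ.* + suc Q ℤ.+ (+ (2 + a) ℤ.- + 3)) ℤ.* + ν     ≡⟨ regroup (+ Q) (+ a) (+ ν) ⟩
  + ν ℤ.* + (suc Q + Q + a)                              ≡⟨ ℤ.pos-* ν (suc Q + Q + a) ⟨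
  + (ν * (suc Q + Q + a))                                ∎)
  where
  open ℤ.≤-Reasoning
  regroup : ∀ x y z → (+ 2 ℤ.* (+ 1 ℤ.+ x) ℤ.+ ((+ 2 ℤ.+ y) ℤ.- + 3)) ℤ.* z ≡ z ℤ.* ((+ 1 ℤ.+ x) ℤ.+ x ℤ.+ y)
  regroup = ℤ.solve-∀

theorem1 : (S : NumericalSemigroup) (m ν c q ρ : ℕ) (w : ℕ → ℕ) (α : ℕ)
    → IsMultiplicity S m
    → IsEmbDim S ν
    → IsConductor S c
    → c + ρ ≡ q * m
    → ρ ≤ m ∸ 1
    → IsAperyEnum S m w
    → 1 < α → α < m ∸ 1
    → w 1 + w α ≤ w (m ∸ 1)
    → .{{_ : NonZero q}}
    → (+ m) ℚ./ 1 ℚ.≤ ((+ 2) ℚ./ 1 ℚ.+ ((+ α) ℤ.- (+ 3)) ℚ./ q) ℚ.* ((+ ν) ℚ./ 1)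
    → c ≤ ν * countBelow S (c ∸ 1)
theorem1 S m ν zero q ρ w α _ _ _ _ _ _ _ _ _ _ = z≤n
theorem1 S zero ν (suc f) q ρ w α (() , _) _ _ _ _ _ _ _ _ _
theorem1 S (suc M) ν (suc f) zero ρ w α _ _ _ () _ _ _ _ _ _
theorem1 S (suc M) ν (suc f) (suc Q) ρ w (suc (suc a)) multiplicity _ conductor c+ρ≡q*m ρ≤M apery
         (s≤s (s≤s z≤n)) α<M w₁+wα≤wM ℚ-bound = begin
  suc f                   ≤⟨ m≤m+n (suc f) ρ ⟩
  suc f + ρ               ≡⟨ c+ρ≡q*m ⟩
  suc Q * suc M           ≤⟨ ℚ-bound⇒q*m≤ν*[2q+α∸3] (suc M) ν Q a ℚ-bound ⟩
  ν * (suc Q + Q + a)     ≤⟨ *-monoʳ-≤ ν (sum-classSize-≥ conductor Q a q*m≤f+m α<m w₁+wα≤f+m) ⟩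
  ν * sum (applyDownFrom (classSize conductor) (3 + a)) ≤⟨ *-monoʳ-≤ ν (sum-classSize≤countBelow conductor (3 + a) α<m) ⟩
  ν * countBelow S f      ∎
  where
  open ≤-Reasoning
  open Apery multiplicity apery
  α<m = m<n⇒m<1+n α<M
  q*m≤f+m : suc Q * suc M ≤ f + suc M
  q*m≤f+m = subst₂ _≤_ c+ρ≡q*m (sym (+-suc f M)) (+-monoʳ-≤ (suc f) ρ≤M)
  w₁+wα≤f+m : w 1 + w (2 + a) ≤ f + suc M
  w₁+wα≤f+m = ≤-trans w₁+wα≤wM (w≤f+m conductor ≤-refl)
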